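{- For every integer $n\ge3$, $\mathrm{sat}^*(n,2C_2)\le 2n$.
   Context: $2C_2$ is the poset on four elements $a<b$, $c<d$ with no other relations (two incomparable 2-element chains). A subfamily $\mathcal G\subseteq\mathcal F\subseteq 2^{[n]}$ is an induced copy of a poset $P$ if there is a bijection $i:P\to\mathcal G$ with $p\le_P q$ iff $i(p)\subseteq i(q)$; $\mathcal F$ is induced $P$-saturating if it has no induced copy of $P$ and adding any $G\in2^{[n]}\setminus\mathcal F$ creates one. $\mathrm{sat}^*(n,P)$ is the minimum size of an induced $P$-saturating family in $2^{[n]}$. -}

module Defs where

open import Data.Nat using (ℕ; _≤_)
open import Data.Bool using (Bool; true; false; T)
open import Data.Fin using (Fin; zero; suc)
open import Data.Fin.Subset using (Subset; _⊆_)
open import Data.List using (List; length; _∷_)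
open import Data.List.Membership.Propositional using (_∈_; _∉_)
open import Data.List.Relation.Unary.Unique.Propositional using (Unique)
open import Data.Product using (Σ; _×_; ∃-syntax)
open import Function.Bundles using (_⇔_)
open import Function.Definitions using (Injective)
open import Relation.Binary.PropositionalEquality using (_≡_)
open import Relation.Nullary using (¬_)

-- A finite poset given by its order relation on Fin k (as a Boolean table).
-- The poset 2C₂ on Fin 4: a = 0 < b = 1, c = 2 < d = 3, no other relations
-- besides reflexivity.
twoC₂-≤ : Fin 4 → Fin 4 → Bool
twoC₂-≤ zero zero = true
twoC₂-≤ zero (suc zero) = true
twoC₂-≤ (suc zero) (suc zero) = true
twoC₂-≤ (suc (suc zero)) (suc (suc zero)) = true
twoC₂-≤ (suc (suc zero)) (suc (suc (suc zero))) = true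
twoC₂-≤ (suc (suc (suc zero))) (suc (suc (suc zero))) = true
twoC₂-≤ _ _ = false

-- A family in 2^[n] is a duplicate-free list of subsets of Fin n.
Family : ℕ → Set
Family n = List (Subset n)

InducedCopy : ∀ {k n} → (Fin k → Fin k → Bool) → Family n → Set
InducedCopy {k} {n} leq F =
  Σ (Fin k → Subset n) λ i →
    Injective _≡_ _≡_ i ×
    (∀ p → i p ∈ F) ×
    (∀ p q → T (leq p q) ⇔ (i p ⊆ i q))

InducedSaturating : ∀ {k n} → (Fin k → Fin k → Bool) → Family n → Set
InducedSaturating {k} {n} leq F =
  Unique F ×
  ¬ InducedCopy leq F ×
  (∀ (G : Subset n) → G ∉ F → InducedCopy leq (G ∷ F))

-- The family consists of the chain of initial segments ∅ ⊂ {0} ⊂ {0,1} ⊂ ⋯ ⊂ [n]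
-- together with the singletons; that is n + 1 + (n − 1) = 2n sets. It has no
-- induced 2C₂: the top of a 2-chain cannot be a singleton (its bottom would be
-- ∅, which lies below everything), so both tops would be initial segments and
-- hence comparable. It is saturating: a new set G is not an initial segment,
-- so some b ∉ G lies below some a ∈ G, and one may take a ≥ 2 since G is not a
-- singleton; then {a} ⊂ G and {b} ⊂ {0,…,a−1} is an induced 2C₂, where a ≥ 2
-- keeps {0,…,a−1} from being a singleton.
module Submission where

open import Defs
open import Data.Nat using (ℕ; _≤_; _*_)
open import Data.List using (length)
open import Data.Product using (Σ; _×_)

open import Data.Bool using (Bool; true; false; T)
open import Data.Empty using (⊥-elim)
open import Data.Fin using (Fin; zero; suc; toℕ)
import Data.Fin.Properties as Fin
open import Data.Fin.Subset using (Subset; inside; outside; ⊥; ⁅_⁆; _∈_; _∉_; _⊆_)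
open import Data.Fin.Subset.Properties
  using (_∈?_; nonempty?; Empty-unique; ∉⊥; ⊥⊆; x∈⁅x⁆; x∈⁅y⁆⇒x≡y; x≢y⇒x∉⁅y⁆; drop-there;
         ⊆-refl; ⊆-reflexive; ⊆-antisym)
open import Data.List using (applyUpTo; map; allFin; _++_) renaming (_∷_ to _∷ˡ_)
open import Data.List.Membership.Propositional using () renaming (_∈_ to _∈ˡ_; _∉_ to _∉ˡ_)
open import Data.List.Membership.Propositional.Properties
  using (∈-applyUpTo⁺; ∈-applyUpTo⁻; ∈-map⁺; ∈-map⁻; ∈-++⁺ˡ; ∈-++⁺ʳ; ∈-++⁻; ∈-allFin)
open import Data.List.Properties using (length-++; length-applyUpTo; length-map; length-tabulate)
open import Data.List.Relation.Unary.Any using () renaming (here to hereˡ; there to thereˡ)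
open import Data.List.Relation.Unary.Unique.Propositional using (Unique)
open import Data.List.Relation.Unary.Unique.Propositional.Properties using (applyUpTo⁺₁; map⁺; allFin⁺; ++⁺)
open import Data.Nat using (zero; suc; _<_; _+_; z≤n; s≤s; s≤s⁻¹)
open import Data.Nat.Properties using (≤-total; ≤-trans; <-≤-trans; <⇒≤; <-irrefl; ≤-reflexive; +-suc; +-identityʳ)
open import Data.Product using (∃; ∃₂; _,_)
open import Data.Sum using (_⊎_; inj₁; inj₂)
import Data.Sum as Sum
open import Data.Vec using ([]; _∷_; here; there)
open import Data.Vec.Properties using (∷-injectiveʳ)
open import Function using (_∘_; id)
open import Function.Bundles using (_⇔_; mk⇔; Equivalence)
open import Relation.Binary.PropositionalEquality using (_≡_; _≢_; refl; sym; trans; cong; cong₂; subst; module ≡-Reasoning)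
open import Relation.Nullary using (¬_; yes; no)

private
  variable
    n : ℕ

IsSingleton : Subset n → Set
IsSingleton G = ∃ λ x → G ≡ ⁅ x ⁆

x∈p⇒⁅x⁆⊆p : ∀ {x : Fin n} {p} → x ∈ p → ⁅ x ⁆ ⊆ p
x∈p⇒⁅x⁆⊆p {x = x} {p} x∈p y∈⁅x⁆ = subst (_∈ p) (sym (x∈⁅y⁆⇒x≡y x y∈⁅x⁆)) x∈p

⁅⁆-injective : ∀ {x y : Fin n} → ⁅ x ⁆ ≡ ⁅ y ⁆ → x ≡ y
⁅⁆-injective {x = x} {y} eq = x∈⁅y⁆⇒x≡y y (subst (x ∈_) eq (x∈⁅x⁆ x))

⊆⁅x⁆⇒≡⁅x⁆⊎≡⊥ : ∀ {x : Fin n} {p} → p ⊆ ⁅ x ⁆ → p ≡ ⁅ x ⁆ ⊎ p ≡ ⊥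
⊆⁅x⁆⇒≡⁅x⁆⊎≡⊥ {x = x} {p} p⊆⁅x⁆ with x ∈? p
... | yes x∈p = inj₁ (⊆-antisym p⊆⁅x⁆ (x∈p⇒⁅x⁆⊆p x∈p))
... | no x∉p = inj₂ (Empty-unique λ (y , y∈p) →
  x∉p (subst (_∈ p) (x∈⁅y⁆⇒x≡y x (p⊆⁅x⁆ y∈p)) y∈p))

prefix : ℕ → Subset n
prefix zero = ⊥
prefix {zero} (suc k) = []
prefix {suc n} (suc k) = inside ∷ prefix k

IsPrefix : Subset n → Set
IsPrefix G = ∃ λ k → G ≡ prefix k

∈-prefix⁺ : ∀ {k} {x : Fin n} → toℕ x < k → x ∈ prefix k
∈-prefix⁺ {k = suc k} {zero} _ = here
∈-prefix⁺ {k = suc k} {suc x} (s≤s x<k) = there (∈-prefix⁺ x<k)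

∈-prefix⁻ : ∀ {k} {x : Fin n} → x ∈ prefix k → toℕ x < k
∈-prefix⁻ {k = zero} x∈⊥ = ⊥-elim (∉⊥ x∈⊥)
∈-prefix⁻ {k = suc k} {zero} here = s≤s z≤n
∈-prefix⁻ {k = suc k} {suc x} (there x∈) = s≤s (∈-prefix⁻ x∈)

prefix-mono : ∀ {k l} → k ≤ l → prefix {n} k ⊆ prefix l
prefix-mono k≤l x∈ = ∈-prefix⁺ (<-≤-trans (∈-prefix⁻ x∈) k≤l)

prefix-total : ∀ k l → prefix {n} k ⊆ prefix l ⊎ prefix l ⊆ prefix k
prefix-total {n} k l = Sum.map (prefix-mono {n}) (prefix-mono {n}) (≤-total k l)

prefix-injective : ∀ {k l} → k < l → l ≤ n → prefix {n} k ≢ prefix l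
prefix-injective {suc n} {zero} {suc l} _ _ ()
prefix-injective {suc n} {suc k} {suc l} (s≤s k<l) (s≤s l≤n) eq =
  prefix-injective k<l l≤n (∷-injectiveʳ eq)

prefix≢⁅suc⁆ : ∀ k (x : Fin n) → prefix k ≢ ⁅ suc x ⁆
prefix≢⁅suc⁆ zero x eq = ∉⊥ (subst (x ∈_) (sym (∷-injectiveʳ eq)) (x∈⁅x⁆ x))
prefix≢⁅suc⁆ (suc k) x ()

prefix-not-singleton : ∀ {k} → 2 ≤ k → 2 ≤ n → ¬ IsSingleton (prefix {n} k)
prefix-not-singleton (s≤s (s≤s _)) (s≤s (s≤s _)) (zero , ())
prefix-not-singleton (s≤s (s≤s _)) (s≤s (s≤s _)) (suc x , ())

Gap : Subset n → Set
Gap G = ∃₂ λ b a → b ∉ G × a ∈ G × toℕ b < toℕ a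

prefix-or-gap : (G : Subset n) → (∃ λ k → k ≤ n × G ≡ prefix k) ⊎ Gap G
prefix-or-gap [] = inj₁ (0 , z≤n , refl)
prefix-or-gap (outside ∷ G) with nonempty? G
... | yes (a , a∈G) = inj₂ (zero , suc a , (λ ()) , there a∈G , s≤s z≤n)
... | no G-empty = inj₁ (0 , z≤n , cong (outside ∷_) (Empty-unique G-empty))
prefix-or-gap (inside ∷ G) with prefix-or-gap G
... | inj₁ (k , k≤n , refl) = inj₁ (suc k , s≤s k≤n , refl)
... | inj₂ (b , a , b∉G , a∈G , b<a) =
  inj₂ (suc b , suc a , b∉G ∘ drop-there , there a∈G , s≤s b<a)

wide-gap : ∀ {G : Subset n} → ¬ IsSingleton G → Gap G →
  ∃₂ λ b a → b ∉ G × a ∈ G × toℕ b < toℕ a × 2 ≤ toℕ a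
wide-gap _ (b , suc (suc a) , b∉G , a∈G , b<a) =
  b , suc (suc a) , b∉G , a∈G , b<a , s≤s (s≤s z≤n)
wide-gap _ (suc _ , suc zero , _ , _ , s≤s ())
wide-gap {G = inside ∷ _} _ (zero , suc zero , 0∉G , _) = ⊥-elim (0∉G here)
wide-gap {G = outside ∷ outside ∷ _} _ (zero , suc zero , _ , there () , _)
wide-gap {G = outside ∷ inside ∷ rest} not-singleton (zero , suc zero , 0∉G , _) with nonempty? rest
... | yes (c , c∈rest) = zero , suc (suc c) , 0∉G , there (there c∈rest) , s≤s z≤n , s≤s (s≤s z≤n)
... | no rest-empty =
  ⊥-elim (not-singleton (suc zero , cong (λ tail → outside ∷ inside ∷ tail) (Empty-unique rest-empty)))

induced-copy : ∀ {k} {leq : Fin k → Fin k → Bool} {F : Family n} (i : Fin k → Subset n) →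
  (∀ p q → T (leq p q) → T (leq q p) → p ≡ q) →
  (∀ p q → T (leq p q) ⇔ (i p ⊆ i q)) →
  (∀ p → i p ∈ˡ F) → InducedCopy leq F
induced-copy i antisym iff i∈F = i , injective , i∈F , iff
  where
  open Equivalence
  injective : ∀ {p q} → i p ≡ i q → p ≡ q
  injective {p} {q} eq =
    antisym p q (from (iff p q) (⊆-reflexive eq)) (from (iff q p) (⊆-reflexive (sym eq)))

pattern 𝐚 = zero
pattern 𝐛 = suc zero
pattern 𝐜 = suc (suc zero)
pattern 𝐝 = suc (suc (suc zero))

twoC₂-antisym : ∀ p q → T (twoC₂-≤ p q) → T (twoC₂-≤ q p) → p ≡ q
twoC₂-antisym 𝐚 𝐚 _ _ = refl
twoC₂-antisym 𝐛 𝐛 _ _ = refl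
twoC₂-antisym 𝐜 𝐜 _ _ = refl
twoC₂-antisym 𝐝 𝐝 _ _ = refl
twoC₂-antisym 𝐚 𝐛 _ ()
twoC₂-antisym 𝐚 𝐜 ()
twoC₂-antisym 𝐚 𝐝 ()
twoC₂-antisym 𝐛 𝐚 ()
twoC₂-antisym 𝐛 𝐜 ()
twoC₂-antisym 𝐛 𝐝 ()
twoC₂-antisym 𝐜 𝐚 ()
twoC₂-antisym 𝐜 𝐛 ()
twoC₂-antisym 𝐜 𝐝 _ ()
twoC₂-antisym 𝐝 𝐚 ()
twoC₂-antisym 𝐝 𝐛 ()
twoC₂-antisym 𝐝 𝐜 ()

holds : ∀ {A B : Subset n} → A ⊆ B → T true ⇔ (A ⊆ B)
holds A⊆B = mk⇔ (λ _ {_} → A⊆B) _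

fails : ∀ {A B : Subset n} → ¬ (A ⊆ B) → T false ⇔ (A ⊆ B)
fails A⊈B = mk⇔ (λ ()) A⊈B

separated : ∀ {z} {A B : Subset n} → z ∈ A → z ∉ B → T false ⇔ (A ⊆ B)
separated z∈A z∉B = fails (λ A⊆B → z∉B (A⊆B z∈A))

module _ {x y : Fin n} {G H : Subset n}
         (x∈G : x ∈ G) (x∉H : x ∉ H) (y∈H : y ∈ H) (y∉G : y ∉ G)
         (G≢⁅x⁆ : G ≢ ⁅ x ⁆) (H≢⁅y⁆ : H ≢ ⁅ y ⁆) where

  private
    chains : Fin 4 → Subset n
    chains 𝐚 = ⁅ x ⁆
    chains 𝐛 = G
    chains 𝐜 = ⁅ y ⁆
    chains 𝐝 = H

    x∉⁅y⁆ : x ∉ ⁅ y ⁆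
    x∉⁅y⁆ = x≢y⇒x∉⁅y⁆ λ x≡y → y∉G (subst (_∈ G) x≡y x∈G)
    y∉⁅x⁆ : y ∉ ⁅ x ⁆
    y∉⁅x⁆ = x≢y⇒x∉⁅y⁆ λ y≡x → x∉H (subst (_∈ H) y≡x y∈H)

    chains-induced : ∀ p q → T (twoC₂-≤ p q) ⇔ (chains p ⊆ chains q)
    chains-induced 𝐚 𝐚 = holds ⊆-refl
    chains-induced 𝐚 𝐛 = holds (x∈p⇒⁅x⁆⊆p x∈G)
    chains-induced 𝐚 𝐜 = separated (x∈⁅x⁆ x) x∉⁅y⁆
    chains-induced 𝐚 𝐝 = separated (x∈⁅x⁆ x) x∉H
    chains-induced 𝐛 𝐚 = fails (λ G⊆⁅x⁆ → G≢⁅x⁆ (⊆-antisym G⊆⁅x⁆ (x∈p⇒⁅x⁆⊆p x∈G)))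
    chains-induced 𝐛 𝐛 = holds ⊆-refl
    chains-induced 𝐛 𝐜 = separated x∈G x∉⁅y⁆
    chains-induced 𝐛 𝐝 = separated x∈G x∉H
    chains-induced 𝐜 𝐚 = separated (x∈⁅x⁆ y) y∉⁅x⁆
    chains-induced 𝐜 𝐛 = separated (x∈⁅x⁆ y) y∉G
    chains-induced 𝐜 𝐜 = holds ⊆-refl
    chains-induced 𝐜 𝐝 = holds (x∈p⇒⁅x⁆⊆p y∈H)
    chains-induced 𝐝 𝐚 = separated y∈H y∉⁅x⁆
    chains-induced 𝐝 𝐛 = separated y∈H y∉G
    chains-induced 𝐝 𝐜 = fails (λ H⊆⁅y⁆ → H≢⁅y⁆ (⊆-antisym H⊆⁅y⁆ (x∈p⇒⁅x⁆⊆p y∈H)))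
    chains-induced 𝐝 𝐝 = holds ⊆-refl

  two-chains-copy : ∀ {F : Family n} → ⁅ x ⁆ ∈ˡ F → G ∈ˡ F → ⁅ y ⁆ ∈ˡ F → H ∈ˡ F →
    InducedCopy twoC₂-≤ F
  two-chains-copy {F} ⁅x⁆∈F G∈F ⁅y⁆∈F H∈F = induced-copy chains twoC₂-antisym chains-induced members
    where
    members : ∀ p → chains p ∈ˡ F
    members 𝐚 = ⁅x⁆∈F
    members 𝐛 = G∈F
    members 𝐜 = ⁅y⁆∈F
    members 𝐝 = H∈F

-- a strictly smaller element sits below a singleton only as ∅, and ∅ lies below everything
above-non-minimum⇒¬singleton : ∀ {k} {leq : Fin k → Fin k → Bool} {F : Family n} →
  ((i , _) : InducedCopy leq F) →
  ∀ p q r → T (leq p q) → p ≢ q → ¬ T (leq p r) → ¬ IsSingleton (i q)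
above-non-minimum⇒¬singleton (i , injective , _ , iff) p q r p≤q p≢q p≰r (x , iq≡⁅x⁆)
  with ⊆⁅x⁆⇒≡⁅x⁆⊎≡⊥ (subst (i p ⊆_) iq≡⁅x⁆ (Equivalence.to (iff p q) p≤q))
... | inj₁ ip≡⁅x⁆ = p≢q (injective (trans ip≡⁅x⁆ (sym iq≡⁅x⁆)))
... | inj₂ ip≡⊥ = p≰r (Equivalence.from (iff p r) (subst (_⊆ i r) (sym ip≡⊥) ⊥⊆))

no-induced-2C₂ : ∀ {F : Family n} (C : Subset n → Set) →
  (∀ {G H} → C G → C H → G ⊆ H ⊎ H ⊆ G) →
  (∀ {G} → G ∈ˡ F → C G ⊎ IsSingleton G) →
  ¬ InducedCopy twoC₂-≤ F
no-induced-2C₂ C total classify copy@(i , _ , i∈F , iff)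
  with classify (i∈F 𝐛) | classify (i∈F 𝐝)
... | inj₂ ib-singleton | _ = above-non-minimum⇒¬singleton copy 𝐚 𝐛 𝐝 _ (λ ()) (λ ()) ib-singleton
... | inj₁ _ | inj₂ id-singleton = above-non-minimum⇒¬singleton copy 𝐜 𝐝 𝐛 _ (λ ()) (λ ()) id-singleton
... | inj₁ Cib | inj₁ Cid with total Cib Cid
...   | inj₁ ib⊆id = Equivalence.from (iff 𝐛 𝐝) ib⊆id
...   | inj₂ id⊆ib = Equivalence.from (iff 𝐝 𝐛) id⊆ib

-- {0} = prefix 1 already occurs among the prefixes, so only the singletons {x}, x ≠ 0, are added
prefixes+singletons : ∀ m → Family (suc m)
prefixes+singletons m = applyUpTo prefix (2 + m) ++ map (⁅_⁆ ∘ suc) (allFin m)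

module _ {m : ℕ} where

  ∈-prefixes+singletons⁻ : ∀ {G} → G ∈ˡ prefixes+singletons m → IsPrefix G ⊎ IsSingleton G
  ∈-prefixes+singletons⁻ G∈ with ∈-++⁻ (applyUpTo prefix (2 + m)) G∈
  ... | inj₁ G∈prefixes = let k , _ , G≡ = ∈-applyUpTo⁻ prefix G∈prefixes in inj₁ (k , G≡)
  ... | inj₂ G∈singletons = let x , _ , G≡ = ∈-map⁻ (⁅_⁆ ∘ suc) G∈singletons in inj₂ (suc x , G≡)

  prefix∈prefixes+singletons : ∀ {k} → k ≤ suc m → prefix k ∈ˡ prefixes+singletons m
  prefix∈prefixes+singletons k≤ = ∈-++⁺ˡ (∈-applyUpTo⁺ prefix (s≤s k≤))

  ⁅⁆∈prefixes+singletons : ∀ x → ⁅ x ⁆ ∈ˡ prefixes+singletons m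
  ⁅⁆∈prefixes+singletons zero = prefix∈prefixes+singletons (s≤s z≤n)
  ⁅⁆∈prefixes+singletons (suc x) = ∈-++⁺ʳ (applyUpTo prefix (2 + m)) (∈-map⁺ (⁅_⁆ ∘ suc) (∈-allFin x))

  prefixes+singletons-unique : Unique (prefixes+singletons m)
  prefixes+singletons-unique = ++⁺
    (applyUpTo⁺₁ prefix (2 + m) λ k<l l<2+m → prefix-injective k<l (s≤s⁻¹ l<2+m))
    (map⁺ (Fin.suc-injective ∘ ⁅⁆-injective) (allFin⁺ m))
    λ (G∈prefixes , G∈singletons) → let
      k , _ , G≡prefix = ∈-applyUpTo⁻ prefix G∈prefixes
      x , _ , G≡⁅x⁆ = ∈-map⁻ (⁅_⁆ ∘ suc) G∈singletons
      in prefix≢⁅suc⁆ k x (trans (sym G≡prefix) G≡⁅x⁆)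

  length-prefixes+singletons : length (prefixes+singletons m) ≡ 2 * suc m
  length-prefixes+singletons = begin
    length (applyUpTo prefix (2 + m) ++ map (⁅_⁆ ∘ suc) (allFin m))
      ≡⟨ length-++ (applyUpTo prefix (2 + m)) ⟩
    length (applyUpTo prefix (2 + m)) + length (map (⁅_⁆ ∘ suc) (allFin m))
      ≡⟨ cong₂ _+_ (length-applyUpTo prefix (2 + m)) (trans (length-map _ (allFin m)) (length-tabulate id)) ⟩
    2 + m + m
      ≡⟨ cong (2 + m +_) (sym (+-identityʳ m)) ⟩
    2 + m + (m + 0)
      ≡⟨ cong suc (sym (+-suc m (m + 0))) ⟩
    2 * suc m
      ∎
    where open ≡-Reasoning

  extension-has-induced-2C₂ : ∀ G → G ∉ˡ prefixes+singletons m →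
    InducedCopy twoC₂-≤ (G ∷ˡ prefixes+singletons m)
  extension-has-induced-2C₂ G G∉ with prefix-or-gap G
  ... | inj₁ (k , k≤ , refl) = ⊥-elim (G∉ (prefix∈prefixes+singletons k≤))
  ... | inj₂ gap with wide-gap (λ { (x , refl) → G∉ (⁅⁆∈prefixes+singletons x) }) gap
  ... | b , a , b∉G , a∈G , b<a , 2≤a =
    two-chains-copy a∈G a∉H b∈H b∉G G≢⁅a⁆ H≢⁅b⁆
      (thereˡ (⁅⁆∈prefixes+singletons a)) (hereˡ refl)
      (thereˡ (⁅⁆∈prefixes+singletons b)) (thereˡ (prefix∈prefixes+singletons a≤n))
    where
    H : Subset (suc m)
    H = prefix (toℕ a)
    a≤n : toℕ a ≤ suc m
    a≤n = <⇒≤ (Fin.toℕ<n a)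
    a∉H : a ∉ H
    a∉H = <-irrefl refl ∘ ∈-prefix⁻
    b∈H : b ∈ H
    b∈H = ∈-prefix⁺ b<a
    G≢⁅a⁆ : G ≢ ⁅ a ⁆
    G≢⁅a⁆ refl = G∉ (⁅⁆∈prefixes+singletons a)
    H≢⁅b⁆ : H ≢ ⁅ b ⁆
    H≢⁅b⁆ H≡⁅b⁆ = prefix-not-singleton 2≤a (≤-trans 2≤a a≤n) (b , H≡⁅b⁆)

  prefixes+singletons-saturating : InducedSaturating twoC₂-≤ (prefixes+singletons m)
  prefixes+singletons-saturating =
    prefixes+singletons-unique ,
    no-induced-2C₂ IsPrefix (λ { (k , refl) (l , refl) → prefix-total k l }) ∈-prefixes+singletons⁻ ,
    extension-has-induced-2C₂

proposition19 : (n : ℕ) → 3 ≤ n →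
    Σ (Family n) λ F → InducedSaturating twoC₂-≤ F × length F ≤ 2 * n
proposition19 zero ()
proposition19 (suc m) _ =
  prefixes+singletons m , prefixes+singletons-saturating , ≤-reflexive length-prefixes+singletons
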